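{- For any word $v=v_1\cdots v_n\in\{a,b\}^n$ with $n\ge0$ and letters $v_i$, one has $|\psi(v)|=\sum_{i=1}^n|\partial\, a\psi(v_i\cdots v_n)b|$.
   Context: Palindromization map on $\{a,b\}^*$: $\psi(\varepsilon)=\varepsilon$, $\psi(ux)=(\psi(u)x)^{(+)}$, where $z^{(+)}$ is the shortest palindrome with prefix $z$. Write a nonempty $u$ uniquely as $x_0^{\alpha_0}\cdots x_m^{\alpha_m}$ with $\alpha_i\ge1$, $x_{i+1}\ne x_i$; the index of $a\psi(u)b$ is $\alpha_0$ (and $0$ if $u=\varepsilon$). With $\varphi_k:a\mapsto a^{k+1}b,\ b\mapsto a^kb$ and $\hat\varphi_k:a\mapsto ab^k,\ b\mapsto ab^{k+1}$, the derivative of $w=a\psi(u)b$ of index $k$ is $\partial ab=a$ if $k=0$, $\partial w=\varphi_k^{ -1}(w)$ if $k>0$ and $u$ begins with $a$, and $\partial w=\hat\varphi_k^{ -1}(w)$ if $k>0$ and $u$ begins with $b$ (well-defined inverse images of injective morphisms). An empty sum is $0$. -}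

module Defs where

open import Data.Nat using (ℕ; zero; suc)
open import Data.Bool using (Bool; true; false; if_then_else_)
open import Data.List using (List; []; _∷_; _++_; [_]; reverse; foldl; replicate; concatMap)
open import Data.List.Properties using (≡-dec)
open import Relation.Binary.PropositionalEquality using (_≡_; refl)
open import Relation.Nullary using (Dec; yes; no; does)

data Letter : Set where
  a b : Letter

_≟L_ : (x y : Letter) → Dec (x ≡ y)
a ≟L a = yes refl
a ≟L b = no (λ ())
b ≟L a = no (λ ())
b ≟L b = yes refl

Word : Set
Word = List Letter

isPal : Word → Bool
isPal w = does (≡-dec _≟L_ w (reverse w))

-- f z = reverse of the prefix p of z, where z = p s and s is the longest
-- palindromic suffix of z
closureTail : Word → Word
closureTail [] = []
closureTail (x ∷ s) = if isPal (x ∷ s) then [] else (closureTail s ++ [ x ])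

-- z⁽⁺⁾ : the shortest palindrome having z as a prefix
_⁽⁺⁾ : Word → Word
z ⁽⁺⁾ = z ++ closureTail z

ψ : Word → Word
ψ u = foldl (λ w x → (w ++ [ x ]) ⁽⁺⁾) [] u

leadRun : Letter → Word → ℕ
leadRun x [] = zero
leadRun x (y ∷ u) = if does (x ≟L y) then suc (leadRun x u) else zero

-- index of aψ(u)b: α₀ for u = x₀^α₀ ⋯, and 0 for u = ε
index : Word → ℕ
index [] = zero
index (x ∷ u) = suc (leadRun x u)

φ : ℕ → Letter → Word
φ k a = replicate (suc k) a ++ [ b ]
φ k b = replicate k a ++ [ b ]

φ̂ : ℕ → Letter → Word
φ̂ k a = a ∷ replicate k b
φ̂ k b = a ∷ replicate (suc k) b

morph : (Letter → Word) → Word → Word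
morph f = concatMap f

aψb : Word → Word
aψb u = a ∷ (ψ u ++ [ b ])

IsDerivative : Word → Word → Set
IsDerivative [] d = d ≡ [ a ]
IsDerivative u@(a ∷ _) d = morph (φ (index u)) d ≡ aψb u
IsDerivative u@(b ∷ _) d = morph (φ̂ (index u)) d ≡ aψb u

suffixes : Word → List Word
suffixes [] = []
suffixes (x ∷ u) = (x ∷ u) ∷ suffixes u

-- Justin's formula ψ(xv) = μₓ(ψ v) x, where μₓ fixes x and sends the other letter y to xy,
-- gives a ψ(xv) b = θₓ(a ψ(v) b) for θ_a = φ̂₀ and θ_b = φ₀.  Together with
-- φₖ₊₁ = θ_a ∘ φₖ and φ̂ₖ₊₁ = θ_b ∘ φ̂ₖ this yields the derivatives.  Every φₖ-image (φ̂ₖ-image) of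
-- a letter contains exactly one b (one a), so ∂ a ψ(xv) b has length #_y (a ψ(xv) b) = #_y (a ψ(v) b),
-- while θₓ lengthens a word by its number of y's; hence |ψ(xv)| = |ψ(v)| + |∂ a ψ(xv) b|.
-- Justin's formula is proved for x = a by tracking the longest palindromic suffix through μ_a,
-- and transported to x = b along the exchange of letters, which commutes with ψ.
module Submission where

open import Defs
open import Data.Bool using (true; false; if_then_else_)
open import Data.List using (List; []; _∷_; _++_; [_]; length; map; reverse; foldl; replicate; filter)
open import Data.List.Properties
  using (++-assoc; length-++; filter-++; map-++; map-∘; map-cong; map-id; map-injective;
         reverse-++; reverse-map; unfold-reverse; ∷-injectiveˡ; ∷-injectiveʳ; ∷ʳ-injectiveˡ;
         concatMap-++; concatMap-map; concatMap-cong; map-concatMap; ≡-dec)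
open import Data.List.Relation.Binary.Pointwise using (Pointwise; []; _∷_)
open import Data.Nat using (ℕ; zero; suc; _+_)
open import Data.Nat.ListAction using (sum)
open import Data.Nat.Properties using (+-comm; +-suc; +-cancelˡ-≡)
open import Data.Product using (_×_; ∃; _,_)
open import Function using (_∘_; mk⇔)
open import Relation.Binary.PropositionalEquality
  using (_≡_; _≢_; refl; sym; trans; cong; cong₂; module ≡-Reasoning)
open import Relation.Nullary.Decidable using (does-⇔; dec-false)
open ≡-Reasoning

swap : Letter → Letter
swap a = b
swap b = a

swap-involutive : ∀ x → swap (swap x) ≡ x
swap-involutive a = refl
swap-involutive b = refl

swap-injective : ∀ {x y} → swap x ≡ swap y → x ≡ y
swap-injective {x} {y} e = trans (sym (swap-involutive x)) (trans (cong swap e) (swap-involutive y))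

a≢b : a ≢ b
a≢b ()

b≢a : b ≢ a
b≢a ()

Pal : Word → Set
Pal w = w ≡ reverse w

isPal-cong : ∀ {u v} → (Pal u → Pal v) → (Pal v → Pal u) → isPal u ≡ isPal v
isPal-cong {u} {v} f g = does-⇔ (mk⇔ f g) (≡-dec _≟L_ u (reverse u)) (≡-dec _≟L_ v (reverse v))

reverse-∷-++-∷ : ∀ {A : Set} (c : A) (m k : List A) (d : A) →
                 reverse (c ∷ m ++ k ++ [ d ]) ≡ d ∷ reverse (m ++ k) ++ [ c ]
reverse-∷-++-∷ c m k d = begin
  reverse (c ∷ m ++ k ++ [ d ])     ≡⟨ cong (λ t → reverse (c ∷ t)) (sym (++-assoc m k [ d ])) ⟩
  reverse (c ∷ (m ++ k) ++ [ d ])   ≡⟨ unfold-reverse c ((m ++ k) ++ [ d ]) ⟩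
  reverse ((m ++ k) ++ [ d ]) ++ [ c ] ≡⟨ cong (_++ [ c ]) (reverse-++ (m ++ k) [ d ]) ⟩
  d ∷ reverse (m ++ k) ++ [ c ]     ∎

-- The middle factor k lets these match words like  μ a s ++ a ∷ b ∷ []  without reassociating.
isPal-∷-++-≢ : ∀ {c d} m k → c ≢ d → isPal (c ∷ m ++ k ++ [ d ]) ≡ false
isPal-∷-++-≢ {c} {d} m k c≢d = dec-false (≡-dec _≟L_ _ _)
  λ pal → c≢d (∷-injectiveˡ (trans pal (reverse-∷-++-∷ c m k d)))

isPal-∷-++-∷ : ∀ c m k → isPal (c ∷ m ++ k ++ [ c ]) ≡ isPal (m ++ k)
isPal-∷-++-∷ c m k = isPal-cong {c ∷ m ++ k ++ [ c ]} {m ++ k}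
  (λ pal → ∷ʳ-injectiveˡ (m ++ k) _
     (trans (++-assoc m k [ c ]) (∷-injectiveʳ (trans pal (reverse-∷-++-∷ c m k c)))))
  (λ pal → trans (cong (c ∷_) (sym (++-assoc m k [ c ])))
     (trans (cong (λ t → c ∷ t ++ [ c ]) pal) (sym (reverse-∷-++-∷ c m k c))))

closureTail-pal : ∀ {c} s → isPal (c ∷ s) ≡ true → closureTail (c ∷ s) ≡ []
closureTail-pal {c} s pal = cong (λ p → if p then [] else closureTail s ++ [ c ]) pal

closureTail-nonpal : ∀ {c} s → isPal (c ∷ s) ≡ false → closureTail (c ∷ s) ≡ closureTail s ++ [ c ]
closureTail-nonpal {c} s nonpal = cong (λ p → if p then [] else closureTail s ++ [ c ]) nonpal

μ₁ μ̃₁ : Letter → Letter → Word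
μ₁ a a = a ∷ []
μ₁ a b = a ∷ b ∷ []
μ₁ b a = b ∷ a ∷ []
μ₁ b b = b ∷ []
μ̃₁ a a = a ∷ []
μ̃₁ a b = b ∷ a ∷ []
μ̃₁ b a = a ∷ b ∷ []
μ̃₁ b b = b ∷ []

μ μ̃ : Letter → Word → Word
μ x = morph (μ₁ x)
μ̃ x = morph (μ̃₁ x)

μ-∷ʳ : ∀ x w → μ x w ++ [ x ] ≡ x ∷ μ̃ x w
μ-∷ʳ a [] = refl
μ-∷ʳ a (a ∷ w) = cong (a ∷_) (μ-∷ʳ a w)
μ-∷ʳ a (b ∷ w) = cong (λ t → a ∷ b ∷ t) (μ-∷ʳ a w)
μ-∷ʳ b [] = refl
μ-∷ʳ b (a ∷ w) = cong (λ t → b ∷ a ∷ t) (μ-∷ʳ b w)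
μ-∷ʳ b (b ∷ w) = cong (b ∷_) (μ-∷ʳ b w)

reverse-μ̃ : ∀ x w → reverse (μ̃ x w) ≡ μ x (reverse w)
reverse-μ̃ x [] = refl
reverse-μ̃ x (c ∷ w) = begin
  reverse (μ̃₁ x c ++ μ̃ x w)           ≡⟨ reverse-++ (μ̃₁ x c) (μ̃ x w) ⟩
  reverse (μ̃ x w) ++ reverse (μ̃₁ x c) ≡⟨ cong₂ _++_ (reverse-μ̃ x w) (reverse-μ̃₁ x c) ⟩
  μ x (reverse w) ++ μ x [ c ]         ≡⟨ sym (concatMap-++ (μ₁ x) (reverse w) [ c ]) ⟩
  μ x (reverse w ++ [ c ])             ≡⟨ cong (μ x) (sym (unfold-reverse c w)) ⟩
  μ x (reverse (c ∷ w))                ∎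
  where
  reverse-μ̃₁ : ∀ x c → reverse (μ̃₁ x c) ≡ μ x [ c ]
  reverse-μ̃₁ a a = refl
  reverse-μ̃₁ a b = refl
  reverse-μ̃₁ b a = refl
  reverse-μ̃₁ b b = refl

μ̃a-injective : ∀ u v → μ̃ a u ≡ μ̃ a v → u ≡ v
μ̃a-injective [] [] e = refl
μ̃a-injective (a ∷ u) (a ∷ v) e = cong (a ∷_) (μ̃a-injective u v (∷-injectiveʳ e))
μ̃a-injective (b ∷ u) (b ∷ v) e = cong (b ∷_) (μ̃a-injective u v (∷-injectiveʳ (∷-injectiveʳ e)))
μ̃a-injective [] (a ∷ v) ()
μ̃a-injective [] (b ∷ v) ()
μ̃a-injective (a ∷ u) [] ()
μ̃a-injective (b ∷ u) [] ()
μ̃a-injective (a ∷ u) (b ∷ v) ()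
μ̃a-injective (b ∷ u) (a ∷ v) ()

isPal-μa-∷ʳ : ∀ w → isPal (μ a w ++ [ a ]) ≡ isPal w
isPal-μa-∷ʳ w = isPal-cong {μ a w ++ [ a ]} {w}
  (λ pal → μ̃a-injective w (reverse w) (∷-injectiveʳ (trans (sym (μ-∷ʳ a w)) (trans pal reversed))))
  (λ pal → trans (μ-∷ʳ a w) (trans (cong (λ t → a ∷ μ̃ a t) pal) (sym reversed)))
  where
  reversed : reverse (μ a w ++ [ a ]) ≡ a ∷ μ̃ a (reverse w)
  reversed = begin
    reverse (μ a w ++ [ a ])    ≡⟨ cong reverse (μ-∷ʳ a w) ⟩
    reverse (a ∷ μ̃ a w)        ≡⟨ unfold-reverse a (μ̃ a w) ⟩
    reverse (μ̃ a w) ++ [ a ]   ≡⟨ cong (_++ [ a ]) (reverse-μ̃ a w) ⟩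
    μ a (reverse w) ++ [ a ]    ≡⟨ μ-∷ʳ a (reverse w) ⟩
    a ∷ μ̃ a (reverse w)        ∎

closureTail-μa-∷ʳ : ∀ z → a ∷ closureTail (μ a z ++ [ a ]) ≡ μ a (closureTail z) ++ [ a ]
closureTail-μa-∷ʳ [] = refl
closureTail-μa-∷ʳ (a ∷ s) with isPal (a ∷ s) in pal
... | true = cong (a ∷_) (closureTail-pal (μ a s ++ [ a ]) (trans (isPal-μa-∷ʳ (a ∷ s)) pal))
... | false = begin
  a ∷ closureTail (a ∷ μ a s ++ [ a ])
    ≡⟨ cong (a ∷_) (closureTail-nonpal (μ a s ++ [ a ]) (trans (isPal-μa-∷ʳ (a ∷ s)) pal)) ⟩
  (a ∷ closureTail (μ a s ++ [ a ])) ++ [ a ]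
    ≡⟨ cong (_++ [ a ]) (closureTail-μa-∷ʳ s) ⟩
  (μ a (closureTail s) ++ [ a ]) ++ [ a ]
    ≡⟨ cong (_++ [ a ]) (sym (concatMap-++ (μ₁ a) (closureTail s) [ a ])) ⟩
  μ a (closureTail s ++ [ a ]) ++ [ a ] ∎
closureTail-μa-∷ʳ (b ∷ s) with isPal (b ∷ s) in pal
... | true = cong (a ∷_) (closureTail-pal (b ∷ μ a s ++ [ a ]) (trans (isPal-μa-∷ʳ (b ∷ s)) pal))
... | false = begin
  a ∷ closureTail (a ∷ b ∷ μ a s ++ [ a ])
    ≡⟨ cong (a ∷_) (closureTail-nonpal (b ∷ μ a s ++ [ a ]) (trans (isPal-μa-∷ʳ (b ∷ s)) pal)) ⟩
  a ∷ closureTail (b ∷ μ a s ++ [ a ]) ++ [ a ]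
    ≡⟨ cong (λ t → a ∷ t ++ [ a ]) (closureTail-nonpal (μ a s ++ [ a ]) (isPal-∷-++-≢ (μ a s) [] b≢a)) ⟩
  a ∷ (closureTail (μ a s ++ [ a ]) ++ [ b ]) ++ [ a ]
    ≡⟨ cong (λ t → (t ++ [ b ]) ++ [ a ]) (closureTail-μa-∷ʳ s) ⟩
  ((μ a (closureTail s) ++ [ a ]) ++ [ b ]) ++ [ a ]
    ≡⟨ cong (_++ [ a ]) (++-assoc (μ a (closureTail s)) [ a ] [ b ]) ⟩
  (μ a (closureTail s) ++ μ a [ b ]) ++ [ a ]
    ≡⟨ cong (_++ [ a ]) (sym (concatMap-++ (μ₁ a) (closureTail s) [ b ])) ⟩
  μ a (closureTail s ++ [ b ]) ++ [ a ] ∎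

μa-++-∷ʳ : ∀ s y → μ a s ++ μ a [ y ] ++ [ a ] ≡ μ a (s ++ [ y ]) ++ [ a ]
μa-++-∷ʳ s y =
  trans (sym (++-assoc (μ a s) (μ a [ y ]) [ a ])) (cong (_++ [ a ]) (sym (concatMap-++ (μ₁ a) s [ y ])))

closureTail-μa-ab : ∀ w → closureTail (μ a w ++ a ∷ b ∷ []) ≡ a ∷ closureTail (μ a w ++ a ∷ b ∷ a ∷ [])
closureTail-μa-ab [] = refl
closureTail-μa-ab (a ∷ s) = begin
  closureTail (a ∷ μ a s ++ a ∷ b ∷ [])
    ≡⟨ closureTail-nonpal (μ a s ++ a ∷ b ∷ []) (isPal-∷-++-≢ (μ a s) [ a ] a≢b) ⟩
  closureTail (μ a s ++ a ∷ b ∷ []) ++ [ a ]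
    ≡⟨ cong (_++ [ a ]) (closureTail-μa-ab s) ⟩
  a ∷ closureTail (μ a s ++ a ∷ b ∷ a ∷ []) ++ [ a ]
    ≡⟨ cong (a ∷_) (sym (closureTail-nonpal (μ a s ++ a ∷ b ∷ a ∷ []) nonpal)) ⟩
  a ∷ closureTail (a ∷ μ a s ++ a ∷ b ∷ a ∷ []) ∎
  where
  nonpal : isPal (a ∷ μ a s ++ a ∷ b ∷ a ∷ []) ≡ false
  nonpal = begin
    isPal (a ∷ μ a s ++ a ∷ b ∷ a ∷ [])  ≡⟨ cong (λ t → isPal (a ∷ t)) (μa-++-∷ʳ s b) ⟩
    isPal (μ a (a ∷ s ++ [ b ]) ++ [ a ]) ≡⟨ isPal-μa-∷ʳ (a ∷ s ++ [ b ]) ⟩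
    isPal (a ∷ s ++ [ b ])                ≡⟨ isPal-∷-++-≢ s [] a≢b ⟩
    false                                 ∎
closureTail-μa-ab (b ∷ s) = split-on-isPal-s
  where
  X = μ a s ++ a ∷ b ∷ []
  Y = μ a s ++ a ∷ b ∷ a ∷ []
  pal-bX : isPal (b ∷ X) ≡ isPal s
  pal-bX = trans (isPal-∷-++-∷ b (μ a s) [ a ]) (isPal-μa-∷ʳ s)
  pal-abY : isPal (a ∷ b ∷ Y) ≡ isPal s
  pal-abY = trans (isPal-∷-++-∷ a (b ∷ μ a s) (a ∷ b ∷ [])) pal-bX
  closureTail-abX : closureTail (a ∷ b ∷ X) ≡ closureTail (b ∷ X) ++ [ a ]
  closureTail-abX = closureTail-nonpal (b ∷ X) (isPal-∷-++-≢ (b ∷ μ a s) [ a ] a≢b)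
  split-on-isPal-s : closureTail (a ∷ b ∷ X) ≡ a ∷ closureTail (a ∷ b ∷ Y)
  split-on-isPal-s with isPal s in pal
  ... | true = begin
    closureTail (a ∷ b ∷ X)      ≡⟨ closureTail-abX ⟩
    closureTail (b ∷ X) ++ [ a ] ≡⟨ cong (_++ [ a ]) (closureTail-pal X (trans pal-bX pal)) ⟩
    a ∷ []                       ≡⟨ cong (a ∷_) (sym (closureTail-pal (b ∷ Y) (trans pal-abY pal))) ⟩
    a ∷ closureTail (a ∷ b ∷ Y)  ∎
  ... | false = begin
    closureTail (a ∷ b ∷ X)               ≡⟨ closureTail-abX ⟩
    closureTail (b ∷ X) ++ [ a ]          ≡⟨ cong (_++ [ a ]) (closureTail-nonpal X (trans pal-bX pal)) ⟩
    (closureTail X ++ [ b ]) ++ [ a ]     ≡⟨ cong (λ t → (t ++ [ b ]) ++ [ a ]) (closureTail-μa-ab s) ⟩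
    a ∷ (closureTail Y ++ [ b ]) ++ [ a ]
      ≡⟨ cong (λ t → a ∷ t ++ [ a ]) (sym (closureTail-nonpal Y nonpal-bY)) ⟩
    a ∷ closureTail (b ∷ Y) ++ [ a ]
      ≡⟨ cong (a ∷_) (sym (closureTail-nonpal (b ∷ Y) (trans pal-abY pal))) ⟩
    a ∷ closureTail (a ∷ b ∷ Y)           ∎
    where
    nonpal-bY : isPal (b ∷ Y) ≡ false
    nonpal-bY = isPal-∷-++-≢ (μ a s) (a ∷ b ∷ []) b≢a

⁽⁺⁾-μa-∷ʳ : ∀ z → (μ a z ++ [ a ]) ⁽⁺⁾ ≡ μ a (z ⁽⁺⁾) ++ [ a ]
⁽⁺⁾-μa-∷ʳ z = begin
  (μ a z ++ [ a ]) ++ closureTail (μ a z ++ [ a ])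
    ≡⟨ ++-assoc (μ a z) [ a ] _ ⟩
  μ a z ++ a ∷ closureTail (μ a z ++ [ a ])
    ≡⟨ cong (μ a z ++_) (closureTail-μa-∷ʳ z) ⟩
  μ a z ++ μ a (closureTail z) ++ [ a ]
    ≡⟨ sym (++-assoc (μ a z) (μ a (closureTail z)) [ a ]) ⟩
  (μ a z ++ μ a (closureTail z)) ++ [ a ]
    ≡⟨ cong (_++ [ a ]) (sym (concatMap-++ (μ₁ a) z (closureTail z))) ⟩
  μ a (z ++ closureTail z) ++ [ a ] ∎

⁽⁺⁾-μa-ab : ∀ w → (μ a w ++ a ∷ b ∷ []) ⁽⁺⁾ ≡ (μ a w ++ a ∷ b ∷ a ∷ []) ⁽⁺⁾
⁽⁺⁾-μa-ab w = begin
  (μ a w ++ a ∷ b ∷ []) ++ closureTail (μ a w ++ a ∷ b ∷ [])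
    ≡⟨ cong ((μ a w ++ a ∷ b ∷ []) ++_) (closureTail-μa-ab w) ⟩
  (μ a w ++ a ∷ b ∷ []) ++ a ∷ closureTail (μ a w ++ a ∷ b ∷ a ∷ [])
    ≡⟨ ++-assoc (μ a w) (a ∷ b ∷ []) _ ⟩
  μ a w ++ a ∷ b ∷ a ∷ closureTail (μ a w ++ a ∷ b ∷ a ∷ [])
    ≡⟨ sym (++-assoc (μ a w) (a ∷ b ∷ a ∷ []) _) ⟩
  (μ a w ++ a ∷ b ∷ a ∷ []) ++ closureTail (μ a w ++ a ∷ b ∷ a ∷ []) ∎

extend : Word → Letter → Word
extend w x = (w ++ [ x ]) ⁽⁺⁾

extend-μa-∷ʳ : ∀ w y → extend (μ a w ++ [ a ]) y ≡ μ a (extend w y) ++ [ a ]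
extend-μa-∷ʳ w y = trans (shift y) (⁽⁺⁾-μa-∷ʳ (w ++ [ y ]))
  where
  shift : ∀ y → ((μ a w ++ [ a ]) ++ [ y ]) ⁽⁺⁾ ≡ (μ a (w ++ [ y ]) ++ [ a ]) ⁽⁺⁾
  shift a = cong (λ t → (t ++ [ a ]) ⁽⁺⁾) (sym (concatMap-++ (μ₁ a) w [ a ]))
  shift b = begin
    ((μ a w ++ [ a ]) ++ [ b ]) ⁽⁺⁾ ≡⟨ cong _⁽⁺⁾ (++-assoc (μ a w) [ a ] [ b ]) ⟩
    (μ a w ++ a ∷ b ∷ []) ⁽⁺⁾       ≡⟨ ⁽⁺⁾-μa-ab w ⟩
    (μ a w ++ a ∷ b ∷ a ∷ []) ⁽⁺⁾   ≡⟨ cong _⁽⁺⁾ (μa-++-∷ʳ w b) ⟩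
    (μ a (w ++ [ b ]) ++ [ a ]) ⁽⁺⁾ ∎

ψ-a∷ : ∀ v → ψ (a ∷ v) ≡ μ a (ψ v) ++ [ a ]
ψ-a∷ v = foldl-extend-μa-∷ʳ v []
  where
  foldl-extend-μa-∷ʳ : ∀ v w → foldl extend (μ a w ++ [ a ]) v ≡ μ a (foldl extend w v) ++ [ a ]
  foldl-extend-μa-∷ʳ [] w = refl
  foldl-extend-μa-∷ʳ (y ∷ v) w =
    trans (cong (λ t → foldl extend t v) (extend-μa-∷ʳ w y)) (foldl-extend-μa-∷ʳ v (extend w y))

map-swap-involutive : ∀ w → map swap (map swap w) ≡ w
map-swap-involutive w = trans (sym (map-∘ w)) (trans (map-cong swap-involutive w) (map-id w))

isPal-map-swap : ∀ w → isPal (map swap w) ≡ isPal w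
isPal-map-swap w = isPal-cong {map swap w} {w}
  (λ pal → map-injective swap-injective (trans pal (sym (reverse-map swap w))))
  (λ pal → trans (cong (map swap) pal) (reverse-map swap w))

closureTail-map-swap : ∀ w → closureTail (map swap w) ≡ map swap (closureTail w)
closureTail-map-swap [] = refl
closureTail-map-swap (c ∷ s) rewrite isPal-map-swap (c ∷ s) with isPal (c ∷ s)
... | true = refl
... | false =
  trans (cong (_++ [ swap c ]) (closureTail-map-swap s)) (sym (map-++ swap (closureTail s) [ c ]))

ψ-map-swap : ∀ v → ψ (map swap v) ≡ map swap (ψ v)
ψ-map-swap v = foldl-extend-map-swap v []
  where
  extend-map-swap : ∀ w y → extend (map swap w) (swap y) ≡ map swap (extend w y)
  extend-map-swap w y = begin
    (map swap w ++ [ swap y ]) ++ closureTail (map swap w ++ [ swap y ])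
      ≡⟨ cong (λ t → t ++ closureTail t) (sym (map-++ swap w [ y ])) ⟩
    map swap (w ++ [ y ]) ++ closureTail (map swap (w ++ [ y ]))
      ≡⟨ cong (map swap (w ++ [ y ]) ++_) (closureTail-map-swap (w ++ [ y ])) ⟩
    map swap (w ++ [ y ]) ++ map swap (closureTail (w ++ [ y ]))
      ≡⟨ sym (map-++ swap (w ++ [ y ]) _) ⟩
    map swap (extend w y) ∎
  foldl-extend-map-swap : ∀ v w → foldl extend (map swap w) (map swap v) ≡ map swap (foldl extend w v)
  foldl-extend-map-swap [] w = refl
  foldl-extend-map-swap (y ∷ v) w =
    trans (cong (λ t → foldl extend t (map swap v)) (extend-map-swap w y))
          (foldl-extend-map-swap v (extend w y))

μ-map-swap : ∀ x w → μ (swap x) (map swap w) ≡ map swap (μ x w)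
μ-map-swap x w = begin
  morph (μ₁ (swap x)) (map swap w)   ≡⟨ concatMap-map (μ₁ (swap x)) swap w ⟩
  morph (μ₁ (swap x) ∘ swap) w       ≡⟨ concatMap-cong (μ₁-swap x) w ⟩
  morph (map swap ∘ μ₁ x) w          ≡⟨ sym (map-concatMap swap (μ₁ x) w) ⟩
  map swap (μ x w)                   ∎
  where
  μ₁-swap : ∀ x c → μ₁ (swap x) (swap c) ≡ map swap (μ₁ x c)
  μ₁-swap a a = refl
  μ₁-swap a b = refl
  μ₁-swap b a = refl
  μ₁-swap b b = refl

ψ-∷ : ∀ x v → ψ (x ∷ v) ≡ μ x (ψ v) ++ [ x ]
ψ-∷ a v = ψ-a∷ v
ψ-∷ b v = begin
  ψ (b ∷ v)                                ≡⟨ cong (λ t → ψ (b ∷ t)) (sym (map-swap-involutive v)) ⟩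
  ψ (map swap (a ∷ v′))                    ≡⟨ ψ-map-swap (a ∷ v′) ⟩
  map swap (ψ (a ∷ v′))                    ≡⟨ cong (map swap) (ψ-a∷ v′) ⟩
  map swap (μ a (ψ v′) ++ [ a ])           ≡⟨ map-++ swap (μ a (ψ v′)) [ a ] ⟩
  map swap (μ a (ψ v′)) ++ [ b ]           ≡⟨ cong (_++ [ b ]) (sym (μ-map-swap a (ψ v′))) ⟩
  μ b (map swap (ψ v′)) ++ [ b ]           ≡⟨ cong (λ t → μ b t ++ [ b ]) (sym (ψ-map-swap v′)) ⟩
  μ b (ψ (map swap v′)) ++ [ b ]           ≡⟨ cong (λ t → μ b (ψ t) ++ [ b ]) (map-swap-involutive v) ⟩
  μ b (ψ v) ++ [ b ]                       ∎
  where
  v′ = map swap v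

θ : Letter → Letter → Word
θ a = μ₁ a
θ b = μ̃₁ b

aψb-∷ : ∀ x v → aψb (x ∷ v) ≡ morph (θ x) (aψb v)
aψb-∷ a v = cong (a ∷_) (begin
  ψ (a ∷ v) ++ [ b ]            ≡⟨ cong (_++ [ b ]) (ψ-∷ a v) ⟩
  (μ a (ψ v) ++ [ a ]) ++ [ b ] ≡⟨ ++-assoc (μ a (ψ v)) [ a ] [ b ] ⟩
  μ a (ψ v) ++ μ a [ b ]        ≡⟨ sym (concatMap-++ (μ₁ a) (ψ v) [ b ]) ⟩
  μ a (ψ v ++ [ b ])            ∎)
aψb-∷ b v = cong (a ∷_) (begin
  ψ (b ∷ v) ++ [ b ]            ≡⟨ cong (_++ [ b ]) (trans (ψ-∷ b v) (μ-∷ʳ b (ψ v))) ⟩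
  b ∷ μ̃ b (ψ v) ++ [ b ]       ≡⟨ cong (b ∷_) (sym (concatMap-++ (μ̃₁ b) (ψ v) [ b ])) ⟩
  b ∷ μ̃ b (ψ v ++ [ b ])       ∎)

morph-∘ : ∀ {f g h : Letter → Word} → (∀ c → f c ≡ morph g (h c)) →
          ∀ w → morph f w ≡ morph g (morph h w)
morph-∘ f≗g∘h [] = refl
morph-∘ {f} {g} {h} f≗g∘h (c ∷ w) =
  trans (cong₂ _++_ (f≗g∘h c) (morph-∘ f≗g∘h w)) (sym (concatMap-++ g (h c) (morph h w)))

φ-zero : ∀ w → morph (φ 0) w ≡ morph (θ b) w
φ-zero = concatMap-cong λ { a → refl ; b → refl }

φ̂-zero : ∀ w → morph (φ̂ 0) w ≡ morph (θ a) w
φ̂-zero = concatMap-cong λ { a → refl ; b → refl }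

φ-suc : ∀ k w → morph (φ (suc k)) w ≡ morph (θ a) (morph (φ k) w)
φ-suc k = morph-∘ λ { a → sym (θa-aⁿb (suc k)) ; b → sym (θa-aⁿb k) }
  where
  θa-aⁿb : ∀ n → morph (θ a) (replicate n a ++ [ b ]) ≡ a ∷ replicate n a ++ [ b ]
  θa-aⁿb zero = refl
  θa-aⁿb (suc n) = cong (a ∷_) (θa-aⁿb n)

φ̂-suc : ∀ k w → morph (φ̂ (suc k)) w ≡ morph (θ b) (morph (φ̂ k) w)
φ̂-suc k = morph-∘ λ { a → cong (λ t → a ∷ b ∷ t) (sym (θb-bⁿ k))
                     ; b → cong (λ t → a ∷ b ∷ b ∷ t) (sym (θb-bⁿ k)) }
  where
  θb-bⁿ : ∀ n → morph (θ b) (replicate n b) ≡ replicate n b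
  θb-bⁿ zero = refl
  θb-bⁿ (suc n) = cong (b ∷_) (θb-bⁿ n)

derivative-φ : ∀ u → ∃ λ d → morph (φ (leadRun a u)) d ≡ aψb u
derivative-φ [] = [ a ] , refl
derivative-φ (a ∷ v) =
  let d , eq = derivative-φ v in
  d , trans (φ-suc (leadRun a v) d) (trans (cong (morph (θ a)) eq) (sym (aψb-∷ a v)))
derivative-φ (b ∷ v) = aψb v , trans (φ-zero (aψb v)) (sym (aψb-∷ b v))

derivative-φ̂ : ∀ u → ∃ λ d → morph (φ̂ (leadRun b u)) d ≡ aψb u
derivative-φ̂ [] = [ b ] , refl
derivative-φ̂ (a ∷ v) = aψb v , trans (φ̂-zero (aψb v)) (sym (aψb-∷ a v))
derivative-φ̂ (b ∷ v) =
  let d , eq = derivative-φ̂ v in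
  d , trans (φ̂-suc (leadRun b v) d) (trans (cong (morph (θ b)) eq) (sym (aψb-∷ b v)))

derivative-exists : ∀ u → ∃ (IsDerivative u)
derivative-exists [] = [ a ] , refl
derivative-exists (a ∷ v) = derivative-φ (a ∷ v)
derivative-exists (b ∷ v) = derivative-φ̂ (b ∷ v)

derivatives-exist : ∀ v → ∃ (Pointwise IsDerivative (suffixes v))
derivatives-exist [] = [] , []
derivatives-exist (x ∷ v) =
  let d , p = derivative-exists (x ∷ v)
      ds , ps = derivatives-exist v
  in d ∷ ds , p ∷ ps

occ : Letter → Word → ℕ
occ y w = length (filter (y ≟L_) w)

occ-++ : ∀ y u v → occ y (u ++ v) ≡ occ y u + occ y v
occ-++ y u v = trans (cong length (filter-++ (y ≟L_) u v)) (length-++ (filter (y ≟L_) u))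

occ-morph-unique : ∀ {y f} → (∀ c → occ y (f c) ≡ 1) → ∀ w → occ y (morph f w) ≡ length w
occ-morph-unique once [] = refl
occ-morph-unique {y} {f} once (c ∷ w) =
  trans (occ-++ y (f c) (morph f w)) (cong₂ _+_ (once c) (occ-morph-unique once w))

occ-b-aⁿb : ∀ n → occ b (replicate n a ++ [ b ]) ≡ 1
occ-b-aⁿb zero = refl
occ-b-aⁿb (suc n) = occ-b-aⁿb n

occ-a-bⁿ : ∀ n → occ a (replicate n b) ≡ 0
occ-a-bⁿ zero = refl
occ-a-bⁿ (suc n) = occ-a-bⁿ n

occ-b-φ : ∀ k c → occ b (φ k c) ≡ 1
occ-b-φ k a = occ-b-aⁿb (suc k)
occ-b-φ k b = occ-b-aⁿb k

occ-a-φ̂ : ∀ k c → occ a (φ̂ k c) ≡ 1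
occ-a-φ̂ k a = cong suc (occ-a-bⁿ k)
occ-a-φ̂ k b = cong suc (occ-a-bⁿ (suc k))

length-derivative : ∀ x v d → IsDerivative (x ∷ v) d → length d ≡ occ (swap x) (aψb (x ∷ v))
length-derivative a v d eq = trans (sym (occ-morph-unique (occ-b-φ _) d)) (cong (occ b) eq)
length-derivative b v d eq = trans (sym (occ-morph-unique (occ-a-φ̂ _) d)) (cong (occ a) eq)

length-θ : ∀ x w → length (morph (θ x) w) ≡ length w + occ (swap x) w
length-θ x [] = refl
length-θ a (a ∷ w) = cong suc (length-θ a w)
length-θ a (b ∷ w) = cong suc (trans (cong suc (length-θ a w)) (sym (+-suc (length w) (occ b w))))
length-θ b (a ∷ w) = cong suc (trans (cong suc (length-θ b w)) (sym (+-suc (length w) (occ a w))))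
length-θ b (b ∷ w) = cong suc (length-θ b w)

occ-θ : ∀ x w → occ (swap x) (morph (θ x) w) ≡ occ (swap x) w
occ-θ x [] = refl
occ-θ a (a ∷ w) = occ-θ a w
occ-θ a (b ∷ w) = cong suc (occ-θ a w)
occ-θ b (a ∷ w) = cong suc (occ-θ b w)
occ-θ b (b ∷ w) = occ-θ b w

length-aψb : ∀ u → length (aψb u) ≡ 2 + length (ψ u)
length-aψb u = cong suc (trans (length-++ (ψ u)) (+-comm (length (ψ u)) 1))

length-ψ-∷ : ∀ x v → length (ψ (x ∷ v)) ≡ occ (swap x) (aψb (x ∷ v)) + length (ψ v)
length-ψ-∷ x v = +-cancelˡ-≡ 2 _ _ (begin
  2 + length (ψ (x ∷ v))                     ≡⟨ sym (length-aψb (x ∷ v)) ⟩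
  length (aψb (x ∷ v))                       ≡⟨ cong length (aψb-∷ x v) ⟩
  length (morph (θ x) (aψb v))               ≡⟨ length-θ x (aψb v) ⟩
  length (aψb v) + occ y (aψb v)             ≡⟨ cong₂ _+_ (length-aψb v) (sym (occ-bracket)) ⟩
  2 + (length (ψ v) + occ y (aψb (x ∷ v)))   ≡⟨ cong (2 +_) (+-comm (length (ψ v)) _) ⟩
  2 + (occ y (aψb (x ∷ v)) + length (ψ v))   ∎)
  where
  y = swap x
  occ-bracket : occ y (aψb (x ∷ v)) ≡ occ y (aψb v)
  occ-bracket = trans (cong (occ y) (aψb-∷ x v)) (occ-θ x (aψb v))

length-ψ≡sum-length-derivatives : ∀ v ds → Pointwise IsDerivative (suffixes v) ds →
                                  length (ψ v) ≡ sum (map length ds)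
length-ψ≡sum-length-derivatives [] [] [] = refl
length-ψ≡sum-length-derivatives (x ∷ v) (d ∷ ds) (p ∷ ps) = begin
  length (ψ (x ∷ v))
    ≡⟨ length-ψ-∷ x v ⟩
  occ (swap x) (aψb (x ∷ v)) + length (ψ v)
    ≡⟨ cong₂ _+_ (sym (length-derivative x v d p)) (length-ψ≡sum-length-derivatives v ds ps) ⟩
  length d + sum (map length ds) ∎

mainTheorem7 : (v : Word) →
    (∃ λ (ds : List Word) → Pointwise IsDerivative (suffixes v) ds)
    × ((ds : List Word) → Pointwise IsDerivative (suffixes v) ds →
        length (ψ v) ≡ sum (map length ds))
mainTheorem7 v = derivatives-exist v , length-ψ≡sum-length-derivatives v
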